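{- For any integer $k\ge2$ and every item sequence $I$, $NFD_k(I)\le\lambda_k\cdot OPT_k(I)+k$.
   Context: Define $\pi_1=2$, $\pi_{i+1}=\pi_i(\pi_i-1)+1$ for $i\ge1$, and $\lambda_j=\sum_{i=1}^{j}\max\{\frac{1}{\pi_i-1},\frac1j\}$ for $j\ge1$. $k$-cardinality constrained bin packing: an input is $I=(a_1,\dots,a_n)\in(0,1]^n$; a feasible assignment is a map $f:\{1,\dots,n\}\to\mathbb{N}$ such that every bin has total size at most $1$ and contains at most $k$ items. $OPT_k(I)$ is the minimum number of non-empty bins of a feasible assignment. Algorithm $NFD_k$: sort the items in non-increasing order of size, then process them in this order with a single current bin: pack the next item into the current bin if it fits (load stays $\le1$) and the bin contains fewer than $k$ items; otherwise close the current bin, open a new bin, and pack the item there. $NFD_k(I)$ is the number of non-empty bins produced.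
   Formalization: The item sizes of every item sequence $I$ are rational numbers in (0,1] rather than real numbers. -}

module Defs where

open import Data.Nat as ℕ using (ℕ; zero; suc; _∸_)
import Data.Nat.Properties as ℕP
open import Data.Integer using (+_)
open import Data.Rational using (ℚ; _+_; _*_; _≤_; _<_; _⊔_; _/_; 0ℚ; 1ℚ)
open import Data.Rational.Properties using (_≤?_)
open import Data.Fin using (Fin)
open import Data.List using (List; []; _∷_; length; map; filter; deduplicate; foldr; allFin; tabulate)
open import Data.Product using (_×_; Σ)
open import Relation.Nullary using (yes; no)
open import Relation.Binary.PropositionalEquality using (_≡_)

ℕ→ℚ : ℕ → ℚ
ℕ→ℚ n = + n / 1

-- 1/n as a rational (only used for n ≥ 1; value at 0 is irrelevant)
inv : ℕ → ℚ
inv zero = 0ℚ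
inv (suc m) = + 1 / suc m

-- πseq t = π_{t+1}:  π_1 = 2, π_{i+1} = π_i (π_i - 1) + 1
πseq : ℕ → ℕ
πseq zero = 2
πseq (suc t) = πseq t ℕ.* (πseq t ∸ 1) ℕ.+ 1

-- λsum j r = Σ_{i=1}^{r} max{1/(π_i - 1), 1/j}
λsum : ℕ → ℕ → ℚ
λsum j zero = 0ℚ
λsum j (suc r) = λsum j r + (inv (πseq r ∸ 1) ⊔ inv j)

λ' : ℕ → ℚ
λ' j = λsum j j

sumℚ : List ℚ → ℚ
sumℚ = foldr _+_ 0ℚ

insertDesc : ℚ → List ℚ → List ℚ
insertDesc x [] = x ∷ []
insertDesc x (y ∷ ys) with y ≤? x
... | yes _ = x ∷ y ∷ ys
... | no _  = y ∷ insertDesc x ys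

sortDesc : List ℚ → List ℚ
sortDesc [] = []
sortDesc (x ∷ xs) = insertDesc x (sortDesc xs)

-- nfGo k L c xs : number of bins opened AFTER the current one,
-- where the current bin has load L and contains c items.
nfGo : ℕ → ℚ → ℕ → List ℚ → ℕ
nfGo k L c [] = 0
nfGo k L c (x ∷ xs) with L + x ≤? 1ℚ | c ℕ.<? k
... | yes _ | yes _ = nfGo k (L + x) (suc c) xs
... | _     | _     = suc (nfGo k x 1 xs)

NF : ℕ → List ℚ → ℕ
NF k [] = 0
NF k (x ∷ xs) = suc (nfGo k x 1 xs)

NFD : ℕ → {n : ℕ} → (Fin n → ℚ) → ℕ
NFD k I = NF k (sortDesc (tabulate I))

itemsIn : {n : ℕ} → (Fin n → ℕ) → ℕ → List (Fin n)
itemsIn f b = filter (λ i → f i ℕ.≟ b) (allFin _)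

binLoad : {n : ℕ} → (Fin n → ℚ) → (Fin n → ℕ) → ℕ → ℚ
binLoad I f b = sumℚ (map I (itemsIn f b))

Feasible : ℕ → {n : ℕ} → (Fin n → ℚ) → (Fin n → ℕ) → Set
Feasible k I f = (b : ℕ) → (binLoad I f b ≤ 1ℚ) × (length (itemsIn f b) ℕ.≤ k)

nonEmptyBins : {n : ℕ} → (Fin n → ℕ) → ℕ
nonEmptyBins f = length (deduplicate ℕ._≟_ (map f (allFin _)))

IsOPT : ℕ → {n : ℕ} → (Fin n → ℚ) → ℕ → Set
IsOPT k I m =
  Σ (_ → ℕ) (λ f → Feasible k I f × nonEmptyBins f ≡ m)
  × ((f : _ → ℕ) → Feasible k I f → m ℕ.≤ nonEmptyBins f)

ValidItems : {n : ℕ} → (Fin n → ℚ) → Set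
ValidItems I = ∀ i → (0ℚ < I i) × (I i ≤ 1ℚ)

{-# OPTIONS --safe #-}
-- Weighting argument.  Let capacity k x be the largest c ≤ k with c·x ≤ 1 and give x the weight
-- w(x) = 1/capacity k x.
--
-- (1) Next Fit on a non-increasing list opens at most Σ w + k bins.  When a bin is closed, either
--     its weight is at least 1 (it holds k items, or all its items have the capacity t of its first
--     item and the overflow forces at least t of them), or the next bin starts with an item of
--     strictly larger capacity, which happens at most k − 1 times.
-- (2) A bin with at most k items and load at most 1/(π_i − 1) weighs at most
--     Σ_{j=i}^{i+k−1} max{1/(π_j − 1), 1/k}.  Items of capacity k weigh at most 1/k each.  An item
--     of capacity c < k with c ≤ π_i − 1 has c = π_i − 1 and size > 1/π_i, so the rest of the bin
--     has load below 1/(π_i − 1) − 1/π_i = 1/(π_{i+1} − 1) and we recurse from i + 1.  If there is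
--     no such item, the items of capacity c with π_i ≤ c < k satisfy w = 1/c ≤ (1 + 1/π_i)·size;
--     two or more of them weigh at most (1 + 1/π_i)/(π_i − 1) = 1/(π_i − 1) + 1/(π_{i+1} − 1), and
--     a single one at most 1/π_i.
-- (3) Summing (2) with i = 1 over the bins of a feasible packing with m bins gives Σ w ≤ λ_k·m.
module Submission where

open import Defs
open import Data.Bool using (if_then_else_)
open import Data.Fin using (Fin)
open import Data.Integer as ℤ using (+≤+)
import Data.Integer.Properties as ℤ
open import Data.List using (List; []; _∷_; _++_; map; length; tabulate; allFin; filter; deduplicate)
open import Data.List.Membership.Propositional using (_∈_; find)
open import Data.List.Membership.Propositional.Properties using (∈-∃++; ∈-map⁺; ∈-deduplicate⁺)
open import Data.List.Properties using (filter-accept; filter-reject; map-∘; length-map; map-tabulate)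
open import Data.List.Relation.Binary.Permutation.Propositional using (_↭_; ↭-sym; ↭⇒↭ₛ)
open import Data.List.Relation.Binary.Permutation.Propositional.Properties
  using (All-resp-↭; ↭-length; shift; map⁺)
import Data.List.Relation.Binary.Permutation.Setoid.Properties as Permutationₛ
open import Data.List.Relation.Unary.All as All using (All; []; _∷_)
open import Data.List.Relation.Unary.All.Properties using (¬Any⇒All¬; tabulate⁺) renaming (map⁺ to All-map⁺)
open import Data.List.Relation.Unary.Any using (Any; here; there; any?)
open import Data.List.Relation.Unary.Linked using (_∷_)
import Data.List.Relation.Unary.Sorted.TotalOrder as Sorted
import Data.List.Sort.InsertionSort.Base as InsertionSort
import Data.List.Sort.InsertionSort.Properties as InsertionSortₚ
open import Data.Nat as ℕ using (ℕ; zero; suc; _∸_; z≤n; s≤s)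
import Data.Nat.Coprimality as Coprime
import Data.Nat.Properties as ℕ
open import Data.Product using (_×_; _,_; proj₁; proj₂; ∃₂; ∃-syntax)
open import Data.Rational as ℚ using (ℚ; mkℚ; _+_; _*_; -_; _≤_; _<_; _⊔_; 0ℚ; 1ℚ; *≤*)
open import Data.Rational.Properties
open import Data.Rational.Solver using (module +-*-Solver)
open import Data.Rational.Unnormalised as ℚᵘ using (*≡*)
import Data.Rational.Unnormalised.Properties as ℚᵘ
open import Data.Sum using (_⊎_; inj₁; inj₂)
open import Function using (_∘_; id)
open import Level using (0ℓ)
open import Relation.Binary.Bundles using (DecTotalOrder)
open import Relation.Binary.Construct.Flip.EqAndOrd using (decTotalOrder)
open import Relation.Binary.PropositionalEquality
  using (_≡_; refl; sym; trans; cong; cong₂; subst; subst₂; setoid; module ≡-Reasoning)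
open import Relation.Nullary using (Dec; yes; no; ¬_; contradiction)
open import Relation.Nullary.Decidable using (dec-true; dec-false; _×-dec_)

open +-*-Solver using (solve; _:+_; _:*_; _:=_; :-_; con)

private
  ℕ→ℚ≡mkℚ : ∀ n → ℕ→ℚ n ≡ mkℚ (ℤ.+ n) 0 (Coprime.sym (Coprime.1-coprimeTo n))
  ℕ→ℚ≡mkℚ n = normalize-coprime (Coprime.sym (Coprime.1-coprimeTo n))

  inv≡mkℚ : ∀ n → inv (suc n) ≡ mkℚ (ℤ.+ 1) n (Coprime.1-coprimeTo (suc n))
  inv≡mkℚ n = normalize-coprime (Coprime.1-coprimeTo (suc n))

ℕ→ℚ-mono-≤ : ∀ {m n} → m ℕ.≤ n → ℕ→ℚ m ≤ ℕ→ℚ n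
ℕ→ℚ-mono-≤ {m} {n} m≤n rewrite ℕ→ℚ≡mkℚ m | ℕ→ℚ≡mkℚ n =
  *≤* (subst₂ ℤ._≤_ (sym (ℤ.*-identityʳ (ℤ.+ m))) (sym (ℤ.*-identityʳ (ℤ.+ n))) (+≤+ m≤n))

ℕ→ℚ-nonNeg : ∀ n → 0ℚ ≤ ℕ→ℚ n
ℕ→ℚ-nonNeg n = ℕ→ℚ-mono-≤ {0} {n} z≤n

ℕ→ℚ-+ : ∀ m n → ℕ→ℚ (m ℕ.+ n) ≡ ℕ→ℚ m + ℕ→ℚ n
ℕ→ℚ-+ m n = toℚᵘ-injective (ℚᵘ.≃-trans embed (ℚᵘ.≃-sym (toℚᵘ-homo-+ (ℕ→ℚ m) (ℕ→ℚ n))))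
  where
  embed : ℚ.toℚᵘ (ℕ→ℚ (m ℕ.+ n)) ℚᵘ.≃ ℚ.toℚᵘ (ℕ→ℚ m) ℚᵘ.+ ℚ.toℚᵘ (ℕ→ℚ n)
  embed rewrite ℕ→ℚ≡mkℚ (m ℕ.+ n) | ℕ→ℚ≡mkℚ m | ℕ→ℚ≡mkℚ n = *≡* (cong (ℤ._* ℤ.+ 1)
    (trans (ℤ.pos-+ m n) (sym (cong₂ ℤ._+_ (ℤ.*-identityʳ (ℤ.+ m)) (ℤ.*-identityʳ (ℤ.+ n))))))

ℕ→ℚ-suc : ∀ n → ℕ→ℚ (suc n) ≡ 1ℚ + ℕ→ℚ n
ℕ→ℚ-suc = ℕ→ℚ-+ 1

ℕ→ℚ-suc-* : ∀ c p → ℕ→ℚ (suc c) * p ≡ ℕ→ℚ c * p + p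
ℕ→ℚ-suc-* c p = trans (cong (_* p) (ℕ→ℚ-suc c))
  (solve 2 (λ c p → (con 1ℚ :+ c) :* p := c :* p :+ p) refl (ℕ→ℚ c) p)

inv-nonNeg : ∀ n → 0ℚ ≤ inv n
inv-nonNeg zero    = ≤-refl
inv-nonNeg (suc n) rewrite inv≡mkℚ n = *≤* (+≤+ z≤n)

inv-antimono-≤ : ∀ {m n} → 1 ℕ.≤ m → m ℕ.≤ n → inv n ≤ inv m
inv-antimono-≤ {suc m} {suc n} _ m≤n rewrite inv≡mkℚ m | inv≡mkℚ n =
  *≤* (subst₂ ℤ._≤_ (sym (ℤ.*-identityˡ (ℤ.+ suc m))) (sym (ℤ.*-identityˡ (ℤ.+ suc n))) (+≤+ m≤n))

ℕ→ℚ*inv : ∀ {n} → 1 ℕ.≤ n → ℕ→ℚ n * inv n ≡ 1ℚ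
ℕ→ℚ*inv {suc n} _ rewrite ℕ→ℚ≡mkℚ (suc n) | inv≡mkℚ n =
  *-inverseʳ (mkℚ (ℤ.+ suc n) 0 (Coprime.sym (Coprime.1-coprimeTo (suc n))))

inv-* : ∀ {m n} → 1 ℕ.≤ m → 1 ℕ.≤ n → inv (m ℕ.* n) ≡ inv m * inv n
inv-* {suc m} {suc n} _ _ rewrite inv≡mkℚ m | inv≡mkℚ n = refl

*-monoˡ-≤-≥0 : ∀ {r p q} → 0ℚ ≤ r → p ≤ q → r * p ≤ r * q
*-monoˡ-≤-≥0 {r} 0≤r = *-monoˡ-≤-nonNeg r {{ℚ.nonNegative 0≤r}}

*-monoʳ-≤-≥0 : ∀ {r p q} → 0ℚ ≤ r → p ≤ q → p * r ≤ q * r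
*-monoʳ-≤-≥0 {r} 0≤r = *-monoʳ-≤-nonNeg r {{ℚ.nonNegative 0≤r}}

p≤q⇒p≤q+r : ∀ {p q r} → 0ℚ ≤ r → p ≤ q → p ≤ q + r
p≤q⇒p≤q+r {p} 0≤r p≤q = subst (_≤ _) (+-identityʳ p) (+-mono-≤ p≤q 0≤r)

p≤q⇒p≤r+q : ∀ {p q r} → 0ℚ ≤ r → p ≤ q → p ≤ r + q
p≤q⇒p≤r+q {p} 0≤r p≤q = subst (_≤ _) (+-identityˡ p) (+-mono-≤ 0≤r p≤q)

+-cancelʳ-≤ : ∀ p q r → p + r ≤ q + r → p ≤ q
+-cancelʳ-≤ p q r p+r≤q+r = subst₂ _≤_ (cancel p) (cancel q) (+-monoˡ-≤ (- r) p+r≤q+r)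
  where
  cancel : ∀ x → x + r + - r ≡ x
  cancel x = solve 2 (λ x r → x :+ r :+ (:- r) := x) refl x r

inv-split : ∀ {m} → 1 ℕ.≤ m → inv m ≡ inv (suc m) + inv (suc m ℕ.* m)
inv-split {suc n} _ = begin
  b                             ≡⟨ sym (*-identityʳ b) ⟩
  b * 1ℚ                        ≡⟨ cong (b *_) (sym (ℕ→ℚ*inv {suc (suc n)} (s≤s z≤n))) ⟩
  b * (ℕ→ℚ (suc (suc n)) * a)   ≡⟨ cong (λ z → b * (z * a)) (ℕ→ℚ-suc (suc n)) ⟩
  b * ((1ℚ + N) * a)            ≡⟨ solve 3 (λ a b N → b :* ((con 1ℚ :+ N) :* a) := a :* (N :* b) :+ a :* b)
                                     refl a b N ⟩
  a * (N * b) + a * b           ≡⟨ cong (λ z → a * z + a * b) (ℕ→ℚ*inv {suc n} (s≤s z≤n)) ⟩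
  a * 1ℚ + a * b                ≡⟨ cong₂ _+_ (*-identityʳ a)
                                     (sym (inv-* {suc (suc n)} {suc n} (s≤s z≤n) (s≤s z≤n))) ⟩
  a + inv (suc (suc n) ℕ.* suc n) ∎
  where
  open ≡-Reasoning
  a = inv (suc (suc n))
  b = inv (suc n)
  N = ℕ→ℚ (suc n)

inv≡[1+inv]*inv-suc : ∀ {m} → 1 ℕ.≤ m → inv m ≡ (1ℚ + inv m) * inv (suc m)
inv≡[1+inv]*inv-suc {m} 1≤m = begin
  inv m                               ≡⟨ inv-split 1≤m ⟩
  inv (suc m) + inv (suc m ℕ.* m)     ≡⟨ cong (inv (suc m) +_) (inv-* {suc m} (s≤s z≤n) 1≤m) ⟩
  inv (suc m) + inv (suc m) * inv m   ≡⟨ solve 2 (λ a b → a :+ a :* b := (con 1ℚ :+ b) :* a)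
                                           refl (inv (suc m)) (inv m) ⟩
  (1ℚ + inv m) * inv (suc m)          ∎
  where open ≡-Reasoning

inv-suc≤ : ∀ m {y} → 1ℚ ≤ ℕ→ℚ (suc m) * y → inv (suc m) ≤ y
inv-suc≤ m {y} 1≤my = subst₂ _≤_ (*-identityʳ (inv (suc m))) cancel
  (*-monoˡ-≤-≥0 (inv-nonNeg (suc m)) 1≤my)
  where
  cancel : inv (suc m) * (ℕ→ℚ (suc m) * y) ≡ y
  cancel = trans (sym (*-assoc (inv (suc m)) (ℕ→ℚ (suc m)) y))
    (trans (cong (_* y) (trans (*-comm (inv (suc m)) _) (ℕ→ℚ*inv {suc m} (s≤s z≤n)))) (*-identityˡ y))

1≤ℕ→ℚ*inv : ∀ {m n} → 1 ℕ.≤ m → m ℕ.≤ n → 1ℚ ≤ ℕ→ℚ n * inv m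
1≤ℕ→ℚ*inv {m} {n} 1≤m m≤n = begin
  1ℚ              ≡⟨ sym (ℕ→ℚ*inv 1≤m) ⟩
  ℕ→ℚ m * inv m   ≤⟨ *-monoʳ-≤-≥0 (inv-nonNeg m) (ℕ→ℚ-mono-≤ m≤n) ⟩
  ℕ→ℚ n * inv m   ∎
  where open ≤-Reasoning

ℕ→ℚ*≤1 : ∀ {m y} → 1 ℕ.≤ m → y ≤ inv m → ℕ→ℚ m * y ≤ 1ℚ
ℕ→ℚ*≤1 {m} 1≤m y≤inv = ≤-trans (*-monoˡ-≤-≥0 (ℕ→ℚ-nonNeg m) y≤inv) (≤-reflexive (ℕ→ℚ*inv 1≤m))

fits-overflows⇒< : ∀ {a b y} → 0ℚ ≤ y → ℕ→ℚ a * y ≤ 1ℚ → 1ℚ < ℕ→ℚ b * y → a ℕ.< b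
fits-overflows⇒< {a} {b} 0≤y ay≤1 1<by with a ℕ.<? b
... | yes a<b = a<b
... | no  a≮b = contradiction
  (<-≤-trans 1<by (≤-trans (*-monoʳ-≤-≥0 0≤y (ℕ→ℚ-mono-≤ (ℕ.≮⇒≥ a≮b))) ay≤1)) (<-irrefl refl)

sumℚ-nonNeg : ∀ {xs} → All (0ℚ ≤_) xs → 0ℚ ≤ sumℚ xs
sumℚ-nonNeg []           = ≤-refl
sumℚ-nonNeg (0≤x ∷ 0≤xs) = +-mono-≤ 0≤x (sumℚ-nonNeg 0≤xs)

sumℚ-↭ : ∀ {xs ys} → xs ↭ ys → sumℚ xs ≡ sumℚ ys
sumℚ-↭ xs↭ys = Permutationₛ.foldr-commMonoid (setoid ℚ) +-0-isCommutativeMonoid (↭⇒↭ₛ xs↭ys)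

sumℚ-map-↭ : ∀ {A : Set} (g : A → ℚ) {xs ys} → xs ↭ ys → sumℚ (map g xs) ≡ sumℚ (map g ys)
sumℚ-map-↭ g xs↭ys = sumℚ-↭ (map⁺ g xs↭ys)

sumℚ-map-nonNeg : ∀ {A : Set} {h : A → ℚ} → (∀ a → 0ℚ ≤ h a) → ∀ xs → 0ℚ ≤ sumℚ (map h xs)
sumℚ-map-nonNeg 0≤h []       = ≤-refl
sumℚ-map-nonNeg 0≤h (x ∷ xs) = +-mono-≤ (0≤h x) (sumℚ-map-nonNeg 0≤h xs)

sumℚ-map-mono-≤ : ∀ {A : Set} {g h : A → ℚ} → (∀ a → g a ≤ h a) → ∀ xs →
  sumℚ (map g xs) ≤ sumℚ (map h xs)
sumℚ-map-mono-≤ g≤h []       = ≤-refl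
sumℚ-map-mono-≤ g≤h (x ∷ xs) = +-mono-≤ (g≤h x) (sumℚ-map-mono-≤ g≤h xs)

sumℚ-map-≤-length* : ∀ {A : Set} {h : A → ℚ} {c} → (∀ a → h a ≤ c) → ∀ xs →
  sumℚ (map h xs) ≤ ℕ→ℚ (length xs) * c
sumℚ-map-≤-length* {c = c} h≤c []       = ≤-reflexive (sym (*-zeroˡ c))
sumℚ-map-≤-length* {h = h} {c} h≤c (x ∷ xs) = begin
  h x + sumℚ (map h xs)          ≤⟨ +-mono-≤ (h≤c x) (sumℚ-map-≤-length* h≤c xs) ⟩
  c + ℕ→ℚ (length xs) * c        ≡⟨ +-comm c _ ⟩
  ℕ→ℚ (length xs) * c + c        ≡⟨ sym (ℕ→ℚ-suc-* (length xs) c) ⟩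
  ℕ→ℚ (suc (length xs)) * c      ∎
  where open ≤-Reasoning

sumℚ-map-≤-* : ∀ (g : ℚ → ℚ) a {xs} → All (λ x → g x ≤ a * x) xs → sumℚ (map g xs) ≤ a * sumℚ xs
sumℚ-map-≤-* g a {[]}     []                = ≤-reflexive (sym (*-zeroʳ a))
sumℚ-map-≤-* g a {x ∷ xs} (gx≤ax ∷ gxs≤axs) = begin
  g x + sumℚ (map g xs)     ≤⟨ +-mono-≤ gx≤ax (sumℚ-map-≤-* g a gxs≤axs) ⟩
  a * x + a * sumℚ xs       ≡⟨ sym (*-distribˡ-+ a x (sumℚ xs)) ⟩
  a * (x + sumℚ xs)         ∎
  where open ≤-Reasoning

↭-pick : ∀ {A : Set} {P : A → Set} {xs} → Any P xs → ∃₂ λ y rest → P y × xs ↭ y ∷ rest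
↭-pick any with y , y∈xs , py ← find any with ys , zs , refl ← ∈-∃++ y∈xs = y , ys ++ zs , py , shift y ys zs

≥-decTotalOrder : DecTotalOrder 0ℓ 0ℓ 0ℓ
≥-decTotalOrder = decTotalOrder ≤-decTotalOrder

open InsertionSort ≥-decTotalOrder using (insert; sort)
open InsertionSortₚ ≥-decTotalOrder using (sort-↭; sort-↗)

SortedDesc : List ℚ → Set
SortedDesc = Sorted.Sorted (DecTotalOrder.totalOrder ≥-decTotalOrder)

insertDesc≡insert : ∀ x xs → insertDesc x xs ≡ insert x xs
insertDesc≡insert x []       = refl
insertDesc≡insert x (y ∷ ys) with y ≤? x
... | yes y≤x = cong (λ b → if b then x ∷ y ∷ ys else y ∷ insert x ys) (sym (dec-true (y ≤? x) y≤x))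
... | no  y≰x = cong₂ (λ b zs → if b then x ∷ y ∷ ys else y ∷ zs)
  (sym (dec-false (y ≤? x) y≰x)) (insertDesc≡insert x ys)

sortDesc≡sort : ∀ xs → sortDesc xs ≡ sort xs
sortDesc≡sort []       = refl
sortDesc≡sort (x ∷ xs) = trans (insertDesc≡insert x (sortDesc xs)) (cong (insert x) (sortDesc≡sort xs))

ValidSize : ℚ → Set
ValidSize x = 0ℚ ≤ x × x ≤ 1ℚ

sizes-nonNeg : ∀ {ys} → All ValidSize ys → 0ℚ ≤ sumℚ ys
sizes-nonNeg vs = sumℚ-nonNeg (All.map proj₁ vs)

fitsFrom : ℚ → ℕ → ℕ → ℕ
fitsFrom x zero    j = j
fitsFrom x (suc f) j with ℕ→ℚ (suc j) * x ≤? 1ℚ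
... | yes _ = fitsFrom x f (suc j)
... | no  _ = j

capacity : ℕ → ℚ → ℕ
capacity k x = fitsFrom x (k ∸ 1) 1

weight : ℕ → ℚ → ℚ
weight k x = inv (capacity k x)

totalWeight : ℕ → List ℚ → ℚ
totalWeight k xs = sumℚ (map (weight k) xs)

weight-nonNeg : ∀ k x → 0ℚ ≤ weight k x
weight-nonNeg k x = inv-nonNeg (capacity k x)

record IsLargestFit (x : ℚ) (lo hi c : ℕ) : Set where
  field
    lo≤c    : lo ℕ.≤ c
    c≤hi    : c ℕ.≤ hi
    fits    : ℕ→ℚ c * x ≤ 1ℚ
    maximal : c ℕ.< hi → 1ℚ < ℕ→ℚ (suc c) * x

fitsFrom-largest : ∀ x f j → ℕ→ℚ j * x ≤ 1ℚ → IsLargestFit x j (j ℕ.+ f) (fitsFrom x f j)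
fitsFrom-largest x zero j jx≤1 = record
  { lo≤c = ℕ.≤-refl ; c≤hi = ℕ.m≤m+n j 0 ; fits = jx≤1
  ; maximal = λ j<j+0 → contradiction (subst (j ℕ.<_) (ℕ.+-identityʳ j) j<j+0) (ℕ.<-irrefl refl) }
fitsFrom-largest x (suc f) j jx≤1 with ℕ→ℚ (suc j) * x ≤? 1ℚ
... | yes sjx≤1 = record
  { lo≤c    = ℕ.≤-trans (ℕ.n≤1+n j) lo≤c
  ; c≤hi    = subst (fitsFrom x f (suc j) ℕ.≤_) (sym (ℕ.+-suc j f)) c≤hi
  ; fits    = fits
  ; maximal = λ c<j+1+f → maximal (subst (fitsFrom x f (suc j) ℕ.<_) (ℕ.+-suc j f) c<j+1+f) }
  where open IsLargestFit (fitsFrom-largest x f (suc j) sjx≤1)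
... | no sjx≰1 = record
  { lo≤c = ℕ.≤-refl ; c≤hi = ℕ.m≤m+n j (suc f) ; fits = jx≤1 ; maximal = λ _ → ≰⇒> sjx≰1 }

module _ {k : ℕ} (1≤k : 1 ℕ.≤ k) where

  capacity-largest : ∀ {x} → x ≤ 1ℚ → IsLargestFit x 1 k (capacity k x)
  capacity-largest {x} x≤1 = subst (λ hi → IsLargestFit x 1 hi (capacity k x)) (ℕ.m+[n∸m]≡n 1≤k)
    (fitsFrom-largest x (k ∸ 1) 1 (subst (_≤ 1ℚ) (sym (*-identityˡ x)) x≤1))

  module _ {x : ℚ} (x≤1 : x ≤ 1ℚ) where
    open IsLargestFit (capacity-largest x≤1) public
      renaming (lo≤c to 1≤capacity; c≤hi to capacity≤k; fits to capacity-fits; maximal to capacity-maximal)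

  ≤-capacity : ∀ {c x} → 0ℚ ≤ x → x ≤ 1ℚ → c ℕ.≤ k → ℕ→ℚ c * x ≤ 1ℚ → c ℕ.≤ capacity k x
  ≤-capacity {c} {x} 0≤x x≤1 c≤k cx≤1 with capacity k x ℕ.<? k
  ... | yes cap<k = ℕ.≤-pred (fits-overflows⇒< 0≤x cx≤1 (capacity-maximal x≤1 cap<k))
  ... | no  cap≮k = ℕ.≤-trans c≤k (ℕ.≮⇒≥ cap≮k)

  capacity-antimono : ∀ {x y} → ValidSize x → ValidSize y → y ≤ x → capacity k x ℕ.≤ capacity k y
  capacity-antimono {x} (_ , x≤1) (0≤y , y≤1) y≤x = ≤-capacity 0≤y y≤1 (capacity≤k x≤1)
    (≤-trans (*-monoˡ-≤-≥0 (ℕ→ℚ-nonNeg (capacity k x)) y≤x) (capacity-fits x≤1))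

  weight-mono : ∀ {x y} → ValidSize x → ValidSize y → y ≤ x → weight k y ≤ weight k x
  weight-mono vx@(_ , x≤1) vy y≤x = inv-antimono-≤ (1≤capacity x≤1) (capacity-antimono vx vy y≤x)

  inv≤weight : ∀ {x} → x ≤ 1ℚ → inv k ≤ weight k x
  inv≤weight x≤1 = inv-antimono-≤ (1≤capacity x≤1) (capacity≤k x≤1)

  inv-suc-capacity≤ : ∀ {x} → x ≤ 1ℚ → capacity k x ℕ.< k → inv (suc (capacity k x)) ≤ x
  inv-suc-capacity≤ {x} x≤1 cap<k = inv-suc≤ (capacity k x) (<⇒≤ (capacity-maximal x≤1 cap<k))

charge-closed-bin : ∀ {n a b p q} → ℕ→ℚ n ≤ a + p → 1ℚ + p ≤ b + q → ℕ→ℚ (suc n) ≤ b + a + q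
charge-closed-bin {n} {a} {b} {p} {q} n≤a+p 1+p≤b+q = begin
  ℕ→ℚ (suc n)      ≡⟨ ℕ→ℚ-suc n ⟩
  1ℚ + ℕ→ℚ n       ≤⟨ +-monoʳ-≤ 1ℚ n≤a+p ⟩
  1ℚ + (a + p)     ≡⟨ solve 3 (λ a p o → o :+ (a :+ p) := a :+ (o :+ p)) refl a p 1ℚ ⟩
  a + (1ℚ + p)     ≤⟨ +-monoʳ-≤ a 1+p≤b+q ⟩
  a + (b + q)      ≡⟨ solve 3 (λ a b q → a :+ (b :+ q) := b :+ a :+ q) refl a b q ⟩
  b + a + q        ∎
  where open ≤-Reasoning

module _ {k : ℕ} (1≤k : 1 ℕ.≤ k) where

  potential : ℚ → ℚ
  potential F = ℕ→ℚ (k ∸ capacity k F)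

  -- The open bin has load L, c items, first (largest) item F, last item ℓ and weight W.
  record OpenBin (L : ℚ) (c : ℕ) (F ℓ W : ℚ) : Set where
    field
      first-valid : ValidSize F
      last-valid  : ValidSize ℓ
      count≤k     : c ℕ.≤ k
      load≤       : L ≤ ℕ→ℚ c * F
      last≤first  : ℓ ≤ F
      weight≥     : ℕ→ℚ c * weight k ℓ ≤ W

  open-fresh : ∀ {x} → ValidSize x → OpenBin x 1 x x (weight k x)
  open-fresh {x} vx = record
    { first-valid = vx ; last-valid = vx ; count≤k = 1≤k
    ; load≤ = ≤-reflexive (sym (*-identityˡ x)) ; last≤first = ≤-refl
    ; weight≥ = ≤-reflexive (*-identityˡ (weight k x)) }

  load-after-add : ∀ {L c F ℓ W x} → OpenBin L c F ℓ W → x ≤ ℓ → L + x ≤ ℕ→ℚ (suc c) * F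
  load-after-add {L} {c} {F} {x = x} bin x≤ℓ = begin
    L + x              ≤⟨ +-mono-≤ load≤ (≤-trans x≤ℓ last≤first) ⟩
    ℕ→ℚ c * F + F      ≡⟨ sym (ℕ→ℚ-suc-* c F) ⟩
    ℕ→ℚ (suc c) * F    ∎
    where
    open OpenBin bin
    open ≤-Reasoning

  packed-nonNeg : ∀ {L c F ℓ W} → OpenBin L c F ℓ W → 0ℚ ≤ W
  packed-nonNeg {c = c} {ℓ = ℓ} bin = ≤-trans
    (subst (_≤ ℕ→ℚ c * weight k ℓ) (*-zeroʳ (ℕ→ℚ c)) (*-monoˡ-≤-≥0 (ℕ→ℚ-nonNeg c) (weight-nonNeg k ℓ)))
    (OpenBin.weight≥ bin)

  open-add : ∀ {L c F ℓ W x} → OpenBin L c F ℓ W → ValidSize x → x ≤ ℓ → c ℕ.< k →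
    OpenBin (L + x) (suc c) F x (W + weight k x)
  open-add {L} {c} {F} {ℓ} {W} {x} bin vx x≤ℓ c<k = record
    { first-valid = first-valid ; last-valid = vx ; count≤k = c<k
    ; load≤ = load-after-add bin x≤ℓ
    ; last≤first = ≤-trans x≤ℓ last≤first
    ; weight≥ = begin
        ℕ→ℚ (suc c) * weight k x            ≡⟨ ℕ→ℚ-suc-* c (weight k x) ⟩
        ℕ→ℚ c * weight k x + weight k x     ≤⟨ +-monoˡ-≤ (weight k x)
                                                 (*-monoˡ-≤-≥0 (ℕ→ℚ-nonNeg c) (weight-mono 1≤k last-valid vx x≤ℓ)) ⟩
        ℕ→ℚ c * weight k ℓ + weight k x     ≤⟨ +-monoˡ-≤ (weight k x) weight≥ ⟩
        W + weight k x                      ∎ }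
    where
    open OpenBin bin
    open ≤-Reasoning

  closed-bin-weight : ∀ {L c F ℓ W x} → OpenBin L c F ℓ W → ValidSize x → x ≤ ℓ →
    capacity k x ≡ capacity k F → c ≡ k ⊎ 1ℚ < L + x → 1ℚ ≤ W
  closed-bin-weight {L} {c} {F} {ℓ} {W} {x} bin vx x≤ℓ same-capacity why = 1≤W (divisor why)
    where
    open OpenBin bin
    open ≤-Reasoning
    1≤W : ∃[ d ] (1 ℕ.≤ d × d ℕ.≤ c × inv d ≤ weight k ℓ) → 1ℚ ≤ W
    1≤W (d , 1≤d , d≤c , inv-d≤) = begin
      1ℚ                    ≤⟨ 1≤ℕ→ℚ*inv 1≤d d≤c ⟩
      ℕ→ℚ c * inv d         ≤⟨ *-monoˡ-≤-≥0 (ℕ→ℚ-nonNeg c) inv-d≤ ⟩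
      ℕ→ℚ c * weight k ℓ    ≤⟨ weight≥ ⟩
      W                     ∎
    divisor : c ≡ k ⊎ 1ℚ < L + x → ∃[ d ] (1 ℕ.≤ d × d ℕ.≤ c × inv d ≤ weight k ℓ)
    divisor (inj₁ c≡k) = k , 1≤k , ℕ.≤-reflexive (sym c≡k) , inv≤weight 1≤k (proj₂ last-valid)
    divisor (inj₂ overflow) = capacity k F , 1≤capacity 1≤k (proj₂ first-valid) ,
      ℕ.≤-pred (fits-overflows⇒< (proj₁ first-valid) (capacity-fits 1≤k (proj₂ first-valid))
        (<-≤-trans overflow (load-after-add bin x≤ℓ))) ,
      subst (λ d → inv d ≤ weight k ℓ) same-capacity (weight-mono 1≤k last-valid vx x≤ℓ)

  close-pays : ∀ {L c F ℓ W x} → OpenBin L c F ℓ W → ValidSize x → x ≤ ℓ →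
    c ≡ k ⊎ 1ℚ < L + x → 1ℚ + potential x ≤ W + potential F
  close-pays {L} {c} {F} {ℓ} {W} {x} bin vx x≤ℓ why
    with ℕ.m≤n⇒m<n∨m≡n (capacity-antimono 1≤k first-valid vx (≤-trans x≤ℓ last≤first))
    where open OpenBin bin
  ... | inj₁ capF<capx = begin
    1ℚ + potential x                     ≡⟨ sym (ℕ→ℚ-suc (k ∸ capacity k x)) ⟩
    ℕ→ℚ (suc (k ∸ capacity k x))         ≤⟨ ℕ→ℚ-mono-≤
                                              (ℕ.∸-monoʳ-< capF<capx (capacity≤k 1≤k (proj₂ vx))) ⟩
    potential F                          ≤⟨ p≤q⇒p≤r+q (packed-nonNeg bin) ≤-refl ⟩
    W + potential F                      ∎
    where open ≤-Reasoning
  ... | inj₂ capF≡capx = begin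
    1ℚ + potential x                     ≡⟨ cong (λ d → 1ℚ + ℕ→ℚ (k ∸ d)) (sym capF≡capx) ⟩
    1ℚ + potential F                     ≤⟨ +-monoˡ-≤ (potential F)
                                              (closed-bin-weight bin vx x≤ℓ (sym capF≡capx) why) ⟩
    W + potential F                      ∎
    where open ≤-Reasoning

  nfGo-close : ∀ {L c F ℓ W x xs} → OpenBin L c F ℓ W → ValidSize x → x ≤ ℓ → c ≡ k ⊎ 1ℚ < L + x →
    ℕ→ℚ (nfGo k x 1 xs) ≤ weight k x + totalWeight k xs + potential x →
    ℕ→ℚ (suc (nfGo k x 1 xs)) ≤ W + totalWeight k (x ∷ xs) + potential F
  nfGo-close {F = F} {W = W} {x} {xs} bin vx x≤ℓ why rest≤ =
    charge-closed-bin {nfGo k x 1 xs} {totalWeight k (x ∷ xs)} {W} {potential x} {potential F}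
      rest≤ (close-pays bin vx x≤ℓ why)

  nfGo-≤ : ∀ xs {L c F ℓ W} → SortedDesc (ℓ ∷ xs) → All ValidSize xs → OpenBin L c F ℓ W →
    ℕ→ℚ (nfGo k L c xs) ≤ W + totalWeight k xs + potential F
  nfGo-≤ [] {F = F} _ _ bin =
    p≤q⇒p≤q+r (ℕ→ℚ-nonNeg (k ∸ capacity k F)) (p≤q⇒p≤q+r ≤-refl (packed-nonNeg bin))
  nfGo-≤ (x ∷ xs) {L} {c} {F} {ℓ} {W} (x≤ℓ ∷ sorted) (vx ∷ vs) bin with L + x ≤? 1ℚ | c ℕ.<? k
  ... | yes _       | yes c<k = subst (ℕ→ℚ (nfGo k (L + x) (suc c) xs) ≤_)
    (cong (_+ potential F) (+-assoc W (weight k x) (totalWeight k xs)))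
    (nfGo-≤ xs sorted vs (open-add bin vx x≤ℓ c<k))
  ... | no overflow | _       = nfGo-close {xs = xs} bin vx x≤ℓ (inj₂ (≰⇒> overflow))
    (nfGo-≤ xs sorted vs (open-fresh vx))
  ... | yes _       | no c≮k  = nfGo-close {xs = xs} bin vx x≤ℓ
    (inj₁ (ℕ.≤-antisym (OpenBin.count≤k bin) (ℕ.≮⇒≥ c≮k))) (nfGo-≤ xs sorted vs (open-fresh vx))

  NF-≤-totalWeight : ∀ xs → SortedDesc xs → All ValidSize xs → ℕ→ℚ (NF k xs) ≤ totalWeight k xs + ℕ→ℚ k
  NF-≤-totalWeight []       _      _         = p≤q⇒p≤r+q ≤-refl (ℕ→ℚ-nonNeg k)
  NF-≤-totalWeight (x ∷ xs) sorted (vx ∷ vs) =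
    subst (ℕ→ℚ (NF k (x ∷ xs)) ≤_) (cong (_+ ℕ→ℚ k) (+-identityˡ (totalWeight k (x ∷ xs))))
      (charge-closed-bin {nfGo k x 1 xs} {totalWeight k (x ∷ xs)} {0ℚ} {potential x} {ℕ→ℚ k}
        (nfGo-≤ xs sorted vs (open-fresh vx)) 1+potential≤k)
    where
    1+potential≤k : 1ℚ + potential x ≤ 0ℚ + ℕ→ℚ k
    1+potential≤k = begin
      1ℚ + potential x                  ≡⟨ sym (ℕ→ℚ-suc (k ∸ capacity k x)) ⟩
      ℕ→ℚ (suc (k ∸ capacity k x))      ≤⟨ ℕ→ℚ-mono-≤ (ℕ.≤-trans (s≤s (ℕ.∸-monoʳ-≤ k (1≤capacity 1≤k (proj₂ vx))))
                                                                 (ℕ.≤-reflexive (ℕ.m+[n∸m]≡n 1≤k))) ⟩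
      ℕ→ℚ k                             ≡⟨ sym (+-identityˡ (ℕ→ℚ k)) ⟩
      0ℚ + ℕ→ℚ k                        ∎
      where open ≤-Reasoning

πpred : ℕ → ℕ
πpred s = πseq s ∸ 1

2≤πseq : ∀ s → 2 ℕ.≤ πseq s
2≤πseq zero    = ℕ.≤-refl
2≤πseq (suc s) =
  ℕ.+-monoˡ-≤ 1 (ℕ.*-mono-≤ (ℕ.≤-trans (ℕ.n≤1+n 1) (2≤πseq s)) (ℕ.∸-monoˡ-≤ 1 (2≤πseq s)))

1≤πpred : ∀ s → 1 ℕ.≤ πpred s
1≤πpred s = ℕ.∸-monoˡ-≤ 1 (2≤πseq s)

πseq≡suc-πpred : ∀ s → πseq s ≡ suc (πpred s)
πseq≡suc-πpred s = sym (ℕ.m+[n∸m]≡n (ℕ.≤-trans (ℕ.n≤1+n 1) (2≤πseq s)))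

πpred-suc : ∀ s → πpred (suc s) ≡ suc (πpred s) ℕ.* πpred s
πpred-suc s = trans (ℕ.m+n∸n≡m (πseq s ℕ.* πpred s) 1) (cong (ℕ._* πpred s) (πseq≡suc-πpred s))

λterm : ℕ → ℕ → ℚ
λterm k s = inv (πpred s) ⊔ inv k

-- λseg k s r = Σ_{i=s+1}^{s+r} max{1/(π_i − 1), 1/k}, since πseq s is π_{s+1}; so λ' k = λseg k 0 k.
λseg : ℕ → ℕ → ℕ → ℚ
λseg k s zero    = 0ℚ
λseg k s (suc r) = λterm k s + λseg k (suc s) r

λterm-nonNeg : ∀ k s → 0ℚ ≤ λterm k s
λterm-nonNeg k s = ≤-trans (inv-nonNeg k) (p≤q⊔p (inv (πpred s)) (inv k))

λseg-nonNeg : ∀ k s r → 0ℚ ≤ λseg k s r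
λseg-nonNeg k s zero    = ≤-refl
λseg-nonNeg k s (suc r) = +-mono-≤ (λterm-nonNeg k s) (λseg-nonNeg k (suc s) r)

λseg-snoc : ∀ k s r → λseg k s (suc r) ≡ λseg k s r + λterm k (s ℕ.+ r)
λseg-snoc k s zero    = trans (+-comm (λterm k s) 0ℚ) (cong (λ t → 0ℚ + λterm k t) (sym (ℕ.+-identityʳ s)))
λseg-snoc k s (suc r) = begin
  λterm k s + λseg k (suc s) (suc r)                      ≡⟨ cong (λterm k s +_) (λseg-snoc k (suc s) r) ⟩
  λterm k s + (λseg k (suc s) r + λterm k (suc s ℕ.+ r))  ≡⟨ sym (+-assoc (λterm k s) _ _) ⟩
  λseg k s (suc r) + λterm k (suc s ℕ.+ r)                ≡⟨ cong (λ t → λseg k s (suc r) + λterm k t)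
                                                               (sym (ℕ.+-suc s r)) ⟩
  λseg k s (suc r) + λterm k (s ℕ.+ suc r)                ∎
  where open ≡-Reasoning

λsum≡λseg : ∀ k r → λsum k r ≡ λseg k 0 r
λsum≡λseg k zero    = refl
λsum≡λseg k (suc r) = trans (cong (_+ λterm k r) (λsum≡λseg k r)) (sym (λseg-snoc k 0 r))

module _ {k : ℕ} (1≤k : 1 ℕ.≤ k) where

  Small : ℚ → Set
  Small y = k ℕ.≤ capacity k y

  Critical : ℕ → ℚ → Set
  Critical s y = capacity k y ℕ.< k × capacity k y ℕ.≤ πpred s

  Medium : ℕ → ℚ → Set
  Medium s y = capacity k y ℕ.< k × πpred s ℕ.< capacity k y

  small? : ∀ y → Dec (Small y)
  small? y = k ℕ.≤? capacity k y

  critical? : ∀ s y → Dec (Critical s y)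
  critical? s y = (capacity k y ℕ.<? k) ×-dec (capacity k y ℕ.≤? πpred s)

  small-weight-≤ : ∀ {y} s → Small y → weight k y ≤ λterm k s
  small-weight-≤ s k≤cap = ≤-trans (inv-antimono-≤ 1≤k k≤cap) (p≤q⊔p (inv (πpred s)) (inv k))

  critical-weight-≤ : ∀ {s y} → ValidSize y → Critical s y → y ≤ inv (πpred s) → weight k y ≤ λterm k s
  critical-weight-≤ {s} {y} (0≤y , y≤1) (cap<k , _) y≤inv =
    ≤-trans (inv-antimono-≤ (1≤πpred s) q≤cap) (p≤p⊔q (inv (πpred s)) (inv k))
    where
    q≤cap : πpred s ℕ.≤ capacity k y
    q≤cap = ℕ.≤-pred (fits-overflows⇒< 0≤y (ℕ→ℚ*≤1 (1≤πpred s) y≤inv) (capacity-maximal 1≤k y≤1 cap<k))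

  critical-rest : ∀ {s y} → ValidSize y → Critical s y → ∀ S → y + S ≤ inv (πpred s) → S ≤ inv (πpred (suc s))
  critical-rest {s} {y} (_ , y≤1) (cap<k , cap≤q) S y+S≤inv =
    subst (λ m → S ≤ inv m) (sym (πpred-suc s)) (+-cancelʳ-≤ S _ y (begin
      S + y                              ≡⟨ +-comm S y ⟩
      y + S                              ≤⟨ y+S≤inv ⟩
      inv q                              ≡⟨ inv-split (1≤πpred s) ⟩
      inv (suc q) + inv (suc q ℕ.* q)    ≡⟨ +-comm (inv (suc q)) _ ⟩
      inv (suc q ℕ.* q) + inv (suc q)    ≤⟨ +-monoʳ-≤ (inv (suc q ℕ.* q)) inv-suc-q≤y ⟩
      inv (suc q ℕ.* q) + y              ∎))
    where
    open ≤-Reasoning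
    q = πpred s
    inv-suc-q≤y : inv (suc q) ≤ y
    inv-suc-q≤y = ≤-trans (inv-antimono-≤ (s≤s z≤n) (s≤s cap≤q)) (inv-suc-capacity≤ 1≤k y≤1 cap<k)

  medium-weight-≤ : ∀ {s y} → Medium s y → weight k y ≤ inv (πpred s)
  medium-weight-≤ {s} (_ , q<cap) = inv-antimono-≤ (1≤πpred s) (ℕ.<⇒≤ q<cap)

  medium-weight-≤-* : ∀ {s y} → ValidSize y × Medium s y → weight k y ≤ (1ℚ + inv (suc (πpred s))) * y
  medium-weight-≤-* {s} {y} ((_ , y≤1) , (cap<k , q<cap)) = begin
    inv c                               ≡⟨ inv≡[1+inv]*inv-suc (ℕ.≤-trans (s≤s z≤n) q<cap) ⟩
    (1ℚ + inv c) * inv (suc c)          ≤⟨ *-monoʳ-≤-≥0 (inv-nonNeg (suc c))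
                                             (+-monoʳ-≤ 1ℚ (inv-antimono-≤ (s≤s z≤n) q<cap)) ⟩
    (1ℚ + inv (suc q)) * inv (suc c)    ≤⟨ *-monoˡ-≤-≥0 (+-mono-≤ (ℕ→ℚ-nonNeg 1) (inv-nonNeg (suc q)))
                                             (inv-suc-capacity≤ 1≤k y≤1 cap<k) ⟩
    (1ℚ + inv (suc q)) * y              ∎
    where
    open ≤-Reasoning
    q = πpred s
    c = capacity k y

  BinBound : ℕ → ℕ → List ℚ → Set
  BinBound s r ys = All ValidSize ys → length ys ℕ.≤ r → sumℚ ys ≤ inv (πpred s) → totalWeight k ys ≤ λseg k s r

  BinBound-↭ : ∀ {s r ys zs} → ys ↭ zs → BinBound s r zs → BinBound s r ys
  BinBound-↭ {s} {r} ys↭zs bound vs len load = subst (_≤ λseg k s r) (sym (sumℚ-map-↭ (weight k) ys↭zs))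
    (bound (All-resp-↭ ys↭zs vs) (subst (ℕ._≤ r) (↭-length ys↭zs) len)
      (subst (_≤ inv (πpred s)) (sumℚ-↭ ys↭zs) load))

  mediums-weight-≤-λseg : ∀ s r ys → All (Medium s) ys → BinBound s r ys
  mediums-weight-≤-λseg s r             []             _         _ _        _ = λseg-nonNeg k s r
  mediums-weight-≤-λseg s zero          (_ ∷ _)        _         _ ()       _
  mediums-weight-≤-λseg s (suc zero)    (_ ∷ _ ∷ _)    _         _ (s≤s ()) _
  mediums-weight-≤-λseg s (suc r)       (_ ∷ [])       (my ∷ []) _ _        _ =
    +-mono-≤ (≤-trans (medium-weight-≤ {s} my) (p≤p⊔q (inv (πpred s)) (inv k))) (λseg-nonNeg k (suc s) r)
  mediums-weight-≤-λseg s (suc (suc r)) ys@(_ ∷ _ ∷ _) ms        vs _       load = begin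
    totalWeight k ys                  ≤⟨ sumℚ-map-≤-* (weight k) a (All.zipWith (medium-weight-≤-* {s}) (vs , ms)) ⟩
    a * sumℚ ys                       ≤⟨ *-monoˡ-≤-≥0 (+-mono-≤ (ℕ→ℚ-nonNeg 1) (inv-nonNeg (suc q))) load ⟩
    (1ℚ + inv (suc q)) * inv q        ≡⟨ solve 2 (λ a b → (con 1ℚ :+ a) :* b := b :+ a :* b) refl (inv (suc q)) (inv q) ⟩
    inv q + inv (suc q) * inv q       ≡⟨ cong (inv q +_) (sym (trans (cong inv (πpred-suc s))
                                           (inv-* {suc q} (s≤s z≤n) (1≤πpred s)))) ⟩
    inv q + inv (πpred (suc s))       ≤⟨ +-mono-≤ (p≤p⊔q (inv q) (inv k))
                                           (p≤q⇒p≤q+r (λseg-nonNeg k (suc (suc s)) r)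
                                             (p≤p⊔q (inv (πpred (suc s))) (inv k))) ⟩
    λseg k s (suc (suc r))            ∎
    where
    open ≤-Reasoning
    q = πpred s
    a = 1ℚ + inv (suc q)

  binWeight-≤-λseg : ∀ s r ys → BinBound s r ys
  binWeight-≤-λseg s zero    []      _ _  _ = ≤-refl
  binWeight-≤-λseg s zero    (_ ∷ _) _ () _
  binWeight-≤-λseg s (suc r) ys vs len load with any? (critical? s) ys | any? small? ys
  ... | yes crit | _ with y , rest , cy , ys↭ ← ↭-pick crit = BinBound-↭ {s} {suc r} ys↭ bound vs len load
    where
    bound : BinBound s (suc r) (y ∷ rest)
    bound (vy ∷ vrest) (s≤s len′) y+rest≤ = +-mono-≤
      (critical-weight-≤ {s} vy cy (≤-trans (p≤q⇒p≤q+r (sizes-nonNeg vrest) ≤-refl) y+rest≤))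
      (binWeight-≤-λseg (suc s) r rest vrest len′ (critical-rest {s} vy cy (sumℚ rest) y+rest≤))
  ... | no _ | yes sm with y , rest , sy , ys↭ ← ↭-pick sm = BinBound-↭ {s} {suc r} ys↭ bound vs len load
    where
    bound : BinBound s (suc r) (y ∷ rest)
    bound (vy ∷ vrest) (s≤s len′) y+rest≤ = begin
      weight k y + totalWeight k rest   ≤⟨ +-mono-≤ (small-weight-≤ (s ℕ.+ r) sy) (binWeight-≤-λseg s r rest vrest len′
                                             (≤-trans (p≤q⇒p≤r+q (proj₁ vy) ≤-refl) y+rest≤)) ⟩
      λterm k (s ℕ.+ r) + λseg k s r    ≡⟨ +-comm (λterm k (s ℕ.+ r)) (λseg k s r) ⟩
      λseg k s r + λterm k (s ℕ.+ r)    ≡⟨ sym (λseg-snoc k s r) ⟩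
      λseg k s (suc r)                  ∎
      where open ≤-Reasoning
  ... | no ¬crit | no ¬sm =
    mediums-weight-≤-λseg s (suc r) ys (All.zipWith medium (¬Any⇒All¬ ys ¬crit , ¬Any⇒All¬ ys ¬sm)) vs len load
    where
    medium : ∀ {y} → ¬ Critical s y × ¬ Small y → Medium s y
    medium (¬cy , ¬sy) = ℕ.≰⇒> ¬sy , ℕ.≰⇒> (λ cap≤q → ¬cy (ℕ.≰⇒> ¬sy , cap≤q))

binSum : ∀ {A : Set} → (A → ℕ) → (A → ℚ) → List A → ℕ → ℚ
binSum f g is b = sumℚ (map g (filter (λ i → f i ℕ.≟ b) is))

module _ {A : Set} (f : A → ℕ) (g : A → ℚ) (0≤g : ∀ a → 0ℚ ≤ g a) where

  binSum-∷-accept : ∀ {i b} is → f i ≡ b → binSum f g (i ∷ is) b ≡ g i + binSum f g is b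
  binSum-∷-accept {i} {b} is fi≡b = cong (sumℚ ∘ map g) (filter-accept (λ j → f j ℕ.≟ b) {i} {is} fi≡b)

  binSum-∷-≥ : ∀ i is b → binSum f g is b ≤ binSum f g (i ∷ is) b
  binSum-∷-≥ i is b with f i ℕ.≟ b
  ... | yes fi≡b = subst (binSum f g is b ≤_) (sym (binSum-∷-accept is fi≡b)) (p≤q⇒p≤r+q (0≤g i) ≤-refl)
  ... | no  fi≢b = ≤-reflexive (sym (cong (sumℚ ∘ map g) (filter-reject (λ j → f j ℕ.≟ b) {i} {is} fi≢b)))

  sum-binSum-∷ : ∀ i is {bs} → f i ∈ bs →
    g i + sumℚ (map (binSum f g is) bs) ≤ sumℚ (map (binSum f g (i ∷ is)) bs)
  sum-binSum-∷ i is {b ∷ bs} (here fi≡b) = begin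
    g i + (binSum f g is b + Σ is)      ≡⟨ sym (+-assoc (g i) (binSum f g is b) (Σ is)) ⟩
    g i + binSum f g is b + Σ is        ≡⟨ cong (_+ Σ is) (sym (binSum-∷-accept is fi≡b)) ⟩
    binSum f g (i ∷ is) b + Σ is        ≤⟨ +-monoʳ-≤ (binSum f g (i ∷ is) b)
                                             (sumℚ-map-mono-≤ (binSum-∷-≥ i is) bs) ⟩
    binSum f g (i ∷ is) b + Σ (i ∷ is)  ∎
    where
    open ≤-Reasoning
    Σ : List A → ℚ
    Σ js = sumℚ (map (binSum f g js) bs)
  sum-binSum-∷ i is {b ∷ bs} (there fi∈bs) = begin
    g i + (binSum f g is b + Σ is)      ≡⟨ solve 3 (λ x y z → x :+ (y :+ z) := y :+ (x :+ z))
                                             refl (g i) (binSum f g is b) (Σ is) ⟩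
    binSum f g is b + (g i + Σ is)      ≤⟨ +-mono-≤ (binSum-∷-≥ i is b) (sum-binSum-∷ i is fi∈bs) ⟩
    binSum f g (i ∷ is) b + Σ (i ∷ is)  ∎
    where
    open ≤-Reasoning
    Σ : List A → ℚ
    Σ js = sumℚ (map (binSum f g js) bs)

  sum-≤-sum-binSum : ∀ is {bs} → (∀ {i} → i ∈ is → f i ∈ bs) → sumℚ (map g is) ≤ sumℚ (map (binSum f g is) bs)
  sum-≤-sum-binSum []       {bs} _    = sumℚ-map-nonNeg (λ _ → ≤-refl) bs
  sum-≤-sum-binSum (i ∷ is) {bs} f∈bs = ≤-trans
    (+-monoʳ-≤ (g i) (sum-≤-sum-binSum is (f∈bs ∘ there)))
    (sum-binSum-∷ i is (f∈bs (here refl)))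

totalWeight-≤-λ*bins : ∀ {k n} (I : Fin n → ℚ) (f : Fin n → ℕ) → 1 ℕ.≤ k → (∀ i → ValidSize (I i)) →
  Feasible k I f → totalWeight k (tabulate I) ≤ ℕ→ℚ (nonEmptyBins f) * λ' k
totalWeight-≤-λ*bins {k} {n} I f 1≤k valid feasible = begin
  totalWeight k (tabulate I)          ≡⟨ cong sumℚ (trans (map-tabulate I (weight k))
                                            (sym (map-tabulate id (weight k ∘ I)))) ⟩
  sumℚ (map (weight k ∘ I) (allFin n)) ≤⟨ sum-≤-sum-binSum f (weight k ∘ I) (weight-nonNeg k ∘ I) (allFin n)
                                            (λ i∈ → ∈-deduplicate⁺ ℕ._≟_ (∈-map⁺ f i∈)) ⟩
  sumℚ (map (binSum f (weight k ∘ I) (allFin n)) bins) ≤⟨ sumℚ-map-≤-length* bin≤λ bins ⟩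
  ℕ→ℚ (length bins) * λ' k           ∎
  where
  open ≤-Reasoning
  bins = deduplicate ℕ._≟_ (map f (allFin n))
  bin≤λ : ∀ b → binSum f (weight k ∘ I) (allFin n) b ≤ λ' k
  bin≤λ b = subst₂ _≤_ (cong sumℚ (sym (map-∘ (itemsIn f b)))) (sym (λsum≡λseg k k))
    (binWeight-≤-λseg 1≤k 0 k (map I (itemsIn f b)) (All-map⁺ (All.universal valid (itemsIn f b)))
      (subst (ℕ._≤ k) (sym (length-map I (itemsIn f b))) (proj₂ (feasible b))) (proj₁ (feasible b)))

NFD-≤-totalWeight : ∀ {k n} (I : Fin n → ℚ) → 1 ℕ.≤ k → (∀ i → ValidSize (I i)) →
  ℕ→ℚ (NFD k I) ≤ totalWeight k (tabulate I) + ℕ→ℚ k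
NFD-≤-totalWeight {k} I 1≤k valid = begin
  ℕ→ℚ (NF k (sortDesc (tabulate I)))          ≡⟨ cong (ℕ→ℚ ∘ NF k) (sortDesc≡sort (tabulate I)) ⟩
  ℕ→ℚ (NF k (sort (tabulate I)))              ≤⟨ NF-≤-totalWeight 1≤k (sort (tabulate I)) (sort-↗ (tabulate I))
                                                   (All-resp-↭ (↭-sym (sort-↭ (tabulate I))) (tabulate⁺ valid)) ⟩
  totalWeight k (sort (tabulate I)) + ℕ→ℚ k   ≡⟨ cong (_+ ℕ→ℚ k) (sumℚ-map-↭ (weight k) (sort-↭ (tabulate I))) ⟩
  totalWeight k (tabulate I) + ℕ→ℚ k          ∎
  where open ≤-Reasoning

theorem11 : (k : ℕ) → 2 ℕ.≤ k → (n : ℕ) → (I : Fin n → ℚ) → ValidItems I →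
    (m : ℕ) → IsOPT k I m →
    ℕ→ℚ (NFD k I) ℚ.≤ λ' k * ℕ→ℚ m + ℕ→ℚ k
theorem11 k 2≤k n I valid m ((f , feasible , bins≡m) , _) = begin
  ℕ→ℚ (NFD k I)                          ≤⟨ NFD-≤-totalWeight I 1≤k valid′ ⟩
  totalWeight k (tabulate I) + ℕ→ℚ k     ≤⟨ +-monoˡ-≤ (ℕ→ℚ k) (totalWeight-≤-λ*bins I f 1≤k valid′ feasible) ⟩
  ℕ→ℚ (nonEmptyBins f) * λ' k + ℕ→ℚ k    ≡⟨ cong (λ b → ℕ→ℚ b * λ' k + ℕ→ℚ k) bins≡m ⟩
  ℕ→ℚ m * λ' k + ℕ→ℚ k                   ≡⟨ cong (_+ ℕ→ℚ k) (*-comm (ℕ→ℚ m) (λ' k)) ⟩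
  λ' k * ℕ→ℚ m + ℕ→ℚ k                   ∎
  where
  open ≤-Reasoning
  1≤k : 1 ℕ.≤ k
  1≤k = ℕ.≤-trans (s≤s z≤n) 2≤k
  valid′ : ∀ i → ValidSize (I i)
  valid′ i = <⇒≤ (proj₁ (valid i)) , proj₂ (valid i)
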